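{- For every finite poset $P$ and every $n$, $Tr(n,P)\ge\max\{La_D(n,P),La_U(n,P)\}$.
   Context: The sets $F_1,\dots,F_{|P|}$ form a copy of a poset $P$ if there is a bijection $i:P\to\{F_1,\dots,F_{|P|}\}$ such that $p<_P p'$ implies $i(p)\subsetneq i(p')$; a family is $P$-free if it contains no copy of $P$. For $X$ a set and $\mathcal F$ a family, $\mathcal F|_X=\{F\cap X:F\in\mathcal F\}$. A family $\mathcal F\subseteq 2^{[n]}$ is trace $P$-free if $\mathcal F|_L$ is $P$-free for every $L\subseteq[n]$, and $Tr(n,P)$ is the maximum size of a trace $P$-free family in $2^{[n]}$. A family $\mathcal D\subseteq 2^{[n]}$ is downward closed if $C\subseteq D\in\mathcal D$ implies $C\in\mathcal D$, and upward closed if $D\in\mathcal D$, $D\subseteq C\subseteq[n]$ implies $C\in\mathcal D$. $La_D(n,P)$ (resp. $La_U(n,P)$) is the maximum size of a $P$-free downward closed (resp. upward closed) family $\mathcal F\subseteq 2^{[n]}$. -}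

module Defs where

open import Data.Nat using (ℕ; _≤_)
open import Data.Fin using (Fin)
open import Data.Fin.Subset using (Subset; _⊆_; _⊂_; _∩_)
open import Data.List using (List; map; length)
open import Data.List.Membership.Propositional using (_∈_)
open import Data.List.Relation.Unary.Unique.Propositional using (Unique)
open import Data.Product using (Σ; _×_; ∃)
open import Relation.Binary.PropositionalEquality using (_≡_)
open import Relation.Nullary using (¬_)
open import Relation.Binary.Structures using (IsStrictPartialOrder)

record FinPoset : Set₁ where
  field
    size  : ℕ
    _<P_  : Fin size → Fin size → Set
    isSPO : IsStrictPartialOrder _≡_ _<P_
open FinPoset public

-- A family of subsets of [n]: a list of subsets (membership is what matters;
-- for sizes we additionally require duplicate-freeness, see below).
Family : ℕ → Set
Family n = List (Subset n)

-- F contains a copy of P: an injective map i from P into F such that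
-- p <_P p' implies i(p) ⊊ i(p').  (Injective into the family = bijection
-- onto |P| distinct members F_1,...,F_|P| of F.)
ContainsCopy : ∀ {n} → FinPoset → Family n → Set
ContainsCopy {n} P F =
  Σ (Fin (size P) → Subset n) λ i →
    (∀ p → i p ∈ F) ×
    (∀ p q → i p ≡ i q → p ≡ q) ×
    (∀ p q → _<P_ P p q → i p ⊂ i q)

PFree : ∀ {n} → FinPoset → Family n → Set
PFree P F = ¬ ContainsCopy P F

trace : ∀ {n} → Family n → Subset n → Family n
trace F L = map (λ A → A ∩ L) F

TracePFree : ∀ {n} → FinPoset → Family n → Set
TracePFree {n} P F = (L : Subset n) → PFree P (trace F L)

DownwardClosed : ∀ {n} → Family n → Set
DownwardClosed F = ∀ C D → C ⊆ D → D ∈ F → C ∈ F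

UpwardClosed : ∀ {n} → Family n → Set
UpwardClosed F = ∀ C D → D ⊆ C → D ∈ F → C ∈ F

IsMaxSize : (n : ℕ) → (Family n → Set) → ℕ → Set
IsMaxSize n Q m =
  (∃ λ F → Unique F × Q F × length F ≡ m) ×
  (∀ F → Unique F → Q F → length F ≤ m)

IsTr : ℕ → FinPoset → ℕ → Set
IsTr n P = IsMaxSize n (TracePFree P)

IsLaD : ℕ → FinPoset → ℕ → Set
IsLaD n P = IsMaxSize n (λ F → PFree P F × DownwardClosed F)

IsLaU : ℕ → FinPoset → ℕ → Set
IsLaU n P = IsMaxSize n (λ F → PFree P F × UpwardClosed F)

module Submission where

-- It suffices to show that every P-free family which is downward closed, or
-- upward closed, is trace P-free; the inequality then follows because the
-- maximum size of families with one property is at most that with a weaker one.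
--
-- Both closure cases are instances of one transfer principle: a copy of P in
-- a family G is carried to a copy in F by any map φ that sends members of G
-- into F, is injective on G and preserves strict inclusion on G.  For a
-- trace F|_L we take
--   * φ = id when F is downward closed (A ∩ L ⊆ A ∈ F, so A ∩ L ∈ F);
--   * φ X = X ∪ ([n] ∖ L) when F is upward closed: A ⊆ (A ∩ L) ∪ ([n] ∖ L),
--     and on subsets of L this map reflects ⊆ and preserves ⊊.
-- Hence a copy of P in some trace F|_L yields a copy in F itself.

open import Defs
open import Data.Nat using (ℕ; _≤_; _⊔_)
open import Data.Nat.Properties using (⊔-lub)
open import Data.Fin.Subset using (Subset; _⊆_; _⊂_; _∩_; _∪_; ∁)
import Data.Fin.Subset as Set
open import Data.Fin.Subset.Properties
  using (_∈?_; p∩q⊆p; p∩q⊆q; x∈p∩q⁺; x∈p∪q⁺; x∈p∪q⁻; x∈p⇒x∉∁p; x∉p⇒x∈∁p; ⊆-reflexive; ⊆-antisym)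
open import Data.List.Membership.Propositional using (_∈_)
open import Data.List.Membership.Propositional.Properties using (∈-map⁻)
open import Data.Product using (∃; _×_; _,_)
open import Data.Sum using (inj₁; inj₂)
open import Relation.Binary.PropositionalEquality using (_≡_; refl; sym)
open import Relation.Nullary using (yes; no)
open import Data.Empty using (⊥-elim)

maxSize-mono : ∀ {n} {Q R : Family n → Set} {m k : ℕ} →
  (∀ F → Q F → R F) → IsMaxSize n Q m → IsMaxSize n R k → m ≤ k
maxSize-mono Q⇒R ((F , unique , QF , refl) , _) (_ , R-bound) =
  R-bound F unique (Q⇒R F QF)

module _ {n : ℕ} where

  transferCopy : (P : FinPoset) (G F : Family n) (φ : Subset n → Subset n) →
    (∀ {X} → X ∈ G → φ X ∈ F) →
    (∀ {X Y} → X ∈ G → Y ∈ G → φ X ≡ φ Y → X ≡ Y) →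
    (∀ {X Y} → X ∈ G → Y ∈ G → X ⊂ Y → φ X ⊂ φ Y) →
    ContainsCopy P G → ContainsCopy P F
  transferCopy P G F φ into injective strict (i , i∈G , i-inj , i-mono) =
    (λ p → φ (i p)) ,
    (λ p → into (i∈G p)) ,
    (λ p q eq → i-inj p q (injective (i∈G p) (i∈G q) eq)) ,
    (λ p q p<q → strict (i∈G p) (i∈G q) (i-mono p q p<q))

  traceMember : {F : Family n} {L X : Subset n} →
    X ∈ trace F L → ∃ λ A → A ∈ F × X ≡ A ∩ L
  traceMember {L = L} = ∈-map⁻ (λ A → A ∩ L)

  traceMember⊆ : {F : Family n} {L X : Subset n} → X ∈ trace F L → X ⊆ L
  traceMember⊆ {L = L} X∈ with traceMember X∈
  ... | A , _ , refl = p∩q⊆q A L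

  pad : Subset n → Subset n → Subset n
  pad L X = X ∪ ∁ L

  ⊆-pad-∩ : (L A : Subset n) → A ⊆ pad L (A ∩ L)
  ⊆-pad-∩ L A {x} x∈A with x ∈? L
  ... | yes x∈L = x∈p∪q⁺ (inj₁ (x∈p∩q⁺ (x∈A , x∈L)))
  ... | no  x∉L = x∈p∪q⁺ (inj₂ (x∉p⇒x∈∁p x∉L))

  pad-reflects-⊆ : (L X Y : Subset n) → X ⊆ L → pad L X ⊆ pad L Y → X ⊆ Y
  pad-reflects-⊆ L X Y X⊆L padX⊆padY {x} x∈X
    with x∈p∪q⁻ Y (∁ L) (padX⊆padY (x∈p∪q⁺ (inj₁ x∈X)))
  ... | inj₁ x∈Y  = x∈Y
  ... | inj₂ x∈∁L = ⊥-elim (x∈p⇒x∉∁p (X⊆L x∈X) x∈∁L)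

  pad-injective : (L X Y : Subset n) → X ⊆ L → Y ⊆ L → pad L X ≡ pad L Y → X ≡ Y
  pad-injective L X Y X⊆L Y⊆L eq =
    ⊆-antisym (pad-reflects-⊆ L X Y X⊆L (⊆-reflexive eq))
              (pad-reflects-⊆ L Y X Y⊆L (⊆-reflexive (sym eq)))

  pad-preserves-⊂ : (L X Y : Subset n) → Y ⊆ L → X ⊂ Y → pad L X ⊂ pad L Y
  pad-preserves-⊂ L X Y Y⊆L (X⊆Y , x , x∈Y , x∉X) = padX⊆padY , x , x∈p∪q⁺ (inj₁ x∈Y) , x∉padX
    where
    padX⊆padY : pad L X ⊆ pad L Y
    padX⊆padY {y} y∈ with x∈p∪q⁻ X (∁ L) y∈
    ... | inj₁ y∈X  = x∈p∪q⁺ (inj₁ (X⊆Y y∈X))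
    ... | inj₂ y∈∁L = x∈p∪q⁺ (inj₂ y∈∁L)
    x∉padX : x Set.∉ pad L X
    x∉padX x∈ with x∈p∪q⁻ X (∁ L) x∈
    ... | inj₁ x∈X  = x∉X x∈X
    ... | inj₂ x∈∁L = x∈p⇒x∉∁p (Y⊆L x∈Y) x∈∁L

  -- A downward closed family contains each of its traces, so P-freeness
  -- passes to all traces.
  downClosed⇒tracePFree : (P : FinPoset) (F : Family n) →
    PFree P F → DownwardClosed F → TracePFree P F
  downClosed⇒tracePFree P F free down L copy =
    free (transferCopy P (trace F L) F (λ X → X) into (λ _ _ eq → eq) (λ _ _ X⊂Y → X⊂Y) copy)
    where
    into : ∀ {X} → X ∈ trace F L → X ∈ F
    into X∈ with traceMember X∈
    ... | A , A∈F , refl = down (A ∩ L) A (p∩q⊆p A L) A∈F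

  -- An upward closed family contains the padding of each trace member, and
  -- padding embeds the trace order-faithfully into F.
  upClosed⇒tracePFree : (P : FinPoset) (F : Family n) →
    PFree P F → UpwardClosed F → TracePFree P F
  upClosed⇒tracePFree P F free up L copy =
    free (transferCopy P (trace F L) F (pad L) into
           (λ X∈ Y∈ → pad-injective L _ _ (traceMember⊆ X∈) (traceMember⊆ Y∈))
           (λ _ Y∈ → pad-preserves-⊂ L _ _ (traceMember⊆ Y∈))
           copy)
    where
    into : ∀ {X} → X ∈ trace F L → pad L X ∈ F
    into X∈ with traceMember X∈
    ... | A , A∈F , refl = up (pad L (A ∩ L)) A (⊆-pad-∩ L A) A∈F

proposition2p6 : (P : FinPoset) (n t d u : ℕ) →
    IsTr n P t → IsLaD n P d → IsLaU n P u → d ⊔ u ≤ t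
proposition2p6 P n t d u isTr isLaD isLaU =
  ⊔-lub (maxSize-mono (λ F (free , down) → downClosed⇒tracePFree P F free down) isLaD isTr)
        (maxSize-mono (λ F (free , up) → upClosed⇒tracePFree P F free up) isLaU isTr)
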